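{- Let $\bm{\gamma}=(\gamma_0,\gamma_1,\ldots)\in\{0,1\}^{\infty}$ and let $K\in\mathbb{Z}_{\geq0}$ be such that $\gamma_i=\gamma_{i\oplus j}$ for all $i,j\in\mathbb{Z}_{\ge0}$ with $j<2^K$. Then for all $a,b\in\mathbb{Z}_{\geq0}$ with $b<2^K$, ${\ast}^{\bm{\gamma}}a+{\ast}^{\bm{0}}b={\ast}^{\bm{\gamma}}(a\oplus b)$.
   Context: Let $\mathcal{B}=\{0,1\}$. Define $\mathbb{I}_0=\{\emptyset\}\times\mathcal{B}$ and $\mathbb{I}_n=2^{\mathbb{I}_{n-1}}\times\mathcal{B}$ for $n\ge1$; a game with activeness is an element of $\mathbb{I}=\bigcup_{n\ge0}\mathbb{I}_n$. A pair $(G,g)$ is written $G^g$; elements of $G$ are its options, $g=1$ meaning active. The outcome $o$ is defined recursively: $o(G^g)=\mathscr{N}$ if $g=1$ and some option has outcome $\mathscr{P}$, and $o(G^g)=\mathscr{P}$ otherwise. The sum is $G^g+H^h=(\{G'^{g'}+H^h:G'^{g'}\in G^g\}\cup\{G^g+H'^{h'}:H'^{h'}\in H^h\})^{\max\{g,h\}}$. $G^g=H^h$ means $o(G^g+X^x)=o(H^h+X^x)$ for all games $X^x$. For $\bm{\gamma}\in\mathcal{B}^\infty$, ${\ast}^{\bm{\gamma}}i=\{{\ast}^{\bm{\gamma}}j:0\le j<i\}^{\gamma_i}$ recursively; $\bm{0}=(0,0,\ldots)$. $\oplus$ denotes bitwise XOR (nim-sum). -}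

module Defs where

open import Data.Nat using (ℕ; zero; suc; _+_; _*_)
open import Data.Nat.DivMod using (_/_; _%_)
open import Data.Bool using (Bool; true; false; _∨_; not; _xor_)
open import Data.Fin using (Fin; zero; suc; splitAt)
open import Data.Sum using (inj₁; inj₂; [_,_]′)
open import Relation.Binary.PropositionalEquality using (_≡_)

-- Bitwise XOR (nim-sum) on ℕ.  Computed bit by bit; the fuel m + n is
-- always enough since each step halves both arguments.
bit : ℕ → Bool
bit n with n % 2
... | zero = false
... | suc _ = true

fromBit : Bool → ℕ
fromBit false = 0
fromBit true  = 1

xorFuel : ℕ → ℕ → ℕ → ℕ
xorFuel zero     m n = 0
xorFuel (suc f) m n = fromBit (bit m xor bit n) + 2 * xorFuel f (m / 2) (n / 2)

_⊕_ : ℕ → ℕ → ℕ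
m ⊕ n = xorFuel (m + n) m n

infixl 6 _⊕_

-- Games with activeness: a finite family of options together with an
-- activeness bit (true = active).
data Game : Set where
  mk : (n : ℕ) → (Fin n → Game) → Bool → Game

data Outcome : Set where
  𝒩 𝒫 : Outcome

anyFin : (n : ℕ) → (Fin n → Bool) → Bool
anyFin zero    p = false
anyFin (suc n) p = p zero ∨ anyFin n (λ i → p (suc i))

isP : Outcome → Bool
isP 𝒫 = true
isP 𝒩 = false

o : Game → Outcome
o (mk n f false) = 𝒫
o (mk n f true) with anyFin n (λ i → isP (o (f i)))
... | true  = 𝒩
... | false = 𝒫

_⊞_ : Game → Game → Game
mk n f g ⊞ mk m h k =
  mk (n + m)
     (λ i → [ (λ i′ → f i′ ⊞ mk m h k) , (λ j → mk n f g ⊞ h j) ]′ (splitAt n i))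
     (g ∨ k)

infixl 6 _⊞_

infix 4 _≈G_
_≈G_ : Game → Game → Set
G ≈G H = (X : Game) → o (G ⊞ X) ≡ o (H ⊞ X)

mutual
  star : (ℕ → Bool) → ℕ → Game
  star γ i = mk i (starOpts γ i) (γ i)

  starOpts : (ℕ → Bool) → (i : ℕ) → Fin i → Game
  starOpts γ (suc i) zero    = star γ i
  starOpts γ (suc i) (suc j) = starOpts γ i j

𝟎 : ℕ → Bool
𝟎 _ = false

-- Induction on the context X and on a + b, comparing winning moves of
-- *^γ a + *b + X and *^γ (a ⊕ b) + X.  Both are equally active, since γ is
-- invariant under ⊕ j for j < 2^K, i.e. constant on the blocks i >> K.
-- A move *^γ(a ⊕ b) → *^γ c is matched, by the mex property of ⊕, by a move
-- to *^γ a′ + *b or *^γ a + *b′ with a′ ⊕ b = c or a ⊕ b′ = c.  Conversely, a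
-- move to *^γ a′ + *b (say) behaves, by induction, like *^γ c with
-- c = a′ ⊕ b ≠ a ⊕ b: for c < a ⊕ b this is a move of *^γ (a ⊕ b), and for
-- c > a ⊕ b the position *^γ (a ⊕ b) + X is itself an option of the 𝒫-position
-- *^γ c + X, which is active because a′ ⊕ b > a ⊕ b with a′ < a forces a′ and
-- a into the same block.

module Submission where

open import Defs
open import Data.Nat using (ℕ; zero; suc; _+_; _*_; _^_; _≤_; _<_; z≤n; s≤s)
open import Data.Nat.Properties
open import Data.Nat.DivMod
  using (_/_; m/n≡1+[m∸n]/n; m/n<m; m/n≤m; /-monoˡ-≤)
open import Data.Nat.Induction using (<-wellFounded)
open import Induction.WellFounded using (Acc; acc)
open import Data.Bool using (Bool; true; false; _∨_; _xor_)
open import Data.Bool.Properties using (∨-identityʳ; ∨-zeroʳ; xor-assoc; xor-same; xor-identityʳ)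
open import Data.Fin using (Fin; zero; suc; splitAt; _↑ˡ_; _↑ʳ_)
open import Data.Fin.Properties using (splitAt-↑ˡ; splitAt-↑ʳ)
open import Data.Sum using (_⊎_; inj₁; inj₂; [_,_]′)
open import Data.Product using (∃; _×_; _,_)
open import Data.Empty using (⊥-elim)
open import Relation.Binary.PropositionalEquality
open import Relation.Binary.Definitions using (tri<; tri≈; tri>)
open import Relation.Nullary using (contradiction)

bitCons : Bool → ℕ → ℕ
bitCons r q = fromBit r + 2 * q

bitCons-suc : ∀ r q → bitCons r (suc q) ≡ 2 + bitCons r q
bitCons-suc false q = *-suc 2 q
bitCons-suc true  q = cong suc (*-suc 2 q)

bitCons-half : ∀ r q → bitCons r q / 2 ≡ q
bitCons-half false zero    = refl
bitCons-half true  zero    = refl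
bitCons-half r     (suc q) = begin
  bitCons r (suc q) / 2  ≡⟨ cong (_/ 2) (bitCons-suc r q) ⟩
  (2 + bitCons r q) / 2  ≡⟨ m/n≡1+[m∸n]/n {2 + bitCons r q} (s≤s (s≤s z≤n)) ⟩
  suc (bitCons r q / 2)  ≡⟨ cong suc (bitCons-half r q) ⟩
  suc q                  ∎
  where open ≡-Reasoning

bit-bitCons : ∀ r q → bit (bitCons r q) ≡ r
bit-bitCons false zero    = refl
bit-bitCons true  zero    = refl
bit-bitCons r     (suc q) = trans (cong bit (bitCons-suc r q)) (bit-bitCons r q)

bitCons-bit-half : ∀ n → bitCons (bit n) (n / 2) ≡ n
bitCons-bit-half zero          = refl
bitCons-bit-half (suc zero)    = refl
bitCons-bit-half (suc (suc n)) = begin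
  bitCons (bit n) ((2 + n) / 2)   ≡⟨ cong (bitCons (bit n)) (m/n≡1+[m∸n]/n {2 + n} (s≤s (s≤s z≤n))) ⟩
  bitCons (bit n) (suc (n / 2))   ≡⟨ bitCons-suc (bit n) (n / 2) ⟩
  2 + bitCons (bit n) (n / 2)     ≡⟨ cong (2 +_) (bitCons-bit-half n) ⟩
  2 + n                           ∎
  where open ≡-Reasoning

data Bits : ℕ → Set where
  bits : (r : Bool) (q : ℕ) → Bits (bitCons r q)

toBits : ∀ n → Bits n
toBits n = subst Bits (bitCons-bit-half n) (bits (bit n) (n / 2))

bitCons-< : ∀ r s {q p} → q < p → bitCons r q < bitCons s p
bitCons-< r s {q} {p} q<p = begin-strict
  fromBit r + 2 * q  ≤⟨ +-monoˡ-≤ (2 * q) (fromBit≤1 r) ⟩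
  suc (2 * q)        <⟨ n<1+n _ ⟩
  suc (suc (2 * q))  ≡⟨ sym (*-suc 2 q) ⟩
  2 * suc q          ≤⟨ *-monoʳ-≤ 2 q<p ⟩
  2 * p              ≤⟨ m≤n+m (2 * p) (fromBit s) ⟩
  fromBit s + 2 * p  ∎
  where
  open ≤-Reasoning
  fromBit≤1 : ∀ r → fromBit r ≤ 1
  fromBit≤1 false = z≤n
  fromBit≤1 true  = s≤s z≤n

bitCons-<-inv : ∀ {r s q p} → bitCons r q < bitCons s p →
                q < p ⊎ (q ≡ p × r ≡ false × s ≡ true)
bitCons-<-inv {r} {s} {q} {p} lt with <-cmp q p
... | tri< q<p _ _ = inj₁ q<p
... | tri> _ _ p<q = ⊥-elim (<-asym lt (bitCons-< s r p<q))
bitCons-<-inv {false} {true}  lt | tri≈ _ refl _ = inj₂ (refl , refl , refl)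
bitCons-<-inv {false} {false} lt | tri≈ _ refl _ = ⊥-elim (<-irrefl refl lt)
bitCons-<-inv {true}  {true}  lt | tri≈ _ refl _ = ⊥-elim (<-irrefl refl lt)
bitCons-<-inv {true}  {false} {q} lt | tri≈ _ refl _ = ⊥-elim (<-asym lt (n<1+n (2 * q)))

half-≤ : ∀ {m f} → m ≤ suc f → m / 2 ≤ f
half-≤ {f = f} m≤1+f =
  ≤-pred (≤-<-trans (/-monoˡ-≤ 2 m≤1+f) (m/n<m (suc f) 2 (s≤s (s≤s z≤n))))

xorFuel-0-0 : ∀ f → xorFuel f 0 0 ≡ 0
xorFuel-0-0 zero    = refl
xorFuel-0-0 (suc f) = cong (2 *_) (xorFuel-0-0 f)

xorFuel-fuel-irrelevant : ∀ {f g m n} → m ≤ f → n ≤ f → m ≤ g → n ≤ g →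
                          xorFuel f m n ≡ xorFuel g m n
xorFuel-fuel-irrelevant {zero}  {g} z≤n z≤n _   _   = sym (xorFuel-0-0 g)
xorFuel-fuel-irrelevant {suc f} {zero} _ _ z≤n z≤n = xorFuel-0-0 (suc f)
xorFuel-fuel-irrelevant {suc f} {suc g} {m} {n} m≤f n≤f m≤g n≤g =
  cong (λ z → fromBit (bit m xor bit n) + 2 * z)
       (xorFuel-fuel-irrelevant (half-≤ m≤f) (half-≤ n≤f) (half-≤ m≤g) (half-≤ n≤g))

⊕-unfold : ∀ m n → m ⊕ n ≡ bitCons (bit m xor bit n) (m / 2 ⊕ n / 2)
⊕-unfold m n = begin
  xorFuel (m + n) m n
    ≡⟨ xorFuel-fuel-irrelevant (m≤m+n m n) (m≤n+m n m) (m≤n⇒m≤1+n (m≤m+n m n)) (m≤n⇒m≤1+n (m≤n+m n m)) ⟩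
  bitCons (bit m xor bit n) (xorFuel (m + n) (m / 2) (n / 2))
    ≡⟨ cong (bitCons (bit m xor bit n)) (xorFuel-fuel-irrelevant m/2≤ n/2≤ (m≤m+n (m / 2) (n / 2)) (m≤n+m (n / 2) (m / 2))) ⟩
  bitCons (bit m xor bit n) (m / 2 ⊕ n / 2) ∎
  where
  open ≡-Reasoning
  m/2≤ : m / 2 ≤ m + n
  m/2≤ = ≤-trans (m/n≤m m 2) (m≤m+n m n)
  n/2≤ : n / 2 ≤ m + n
  n/2≤ = ≤-trans (m/n≤m n 2) (m≤n+m n m)

bitCons-⊕ : ∀ r q s p → bitCons r q ⊕ bitCons s p ≡ bitCons (r xor s) (q ⊕ p)
bitCons-⊕ r q s p = trans (⊕-unfold (bitCons r q) (bitCons s p))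
  (cong₂ bitCons (cong₂ _xor_ (bit-bitCons r q) (bit-bitCons s p))
                 (cong₂ _⊕_ (bitCons-half r q) (bitCons-half s p)))

bit-⊕ : ∀ m n → bit (m ⊕ n) ≡ bit m xor bit n
bit-⊕ m n = trans (cong bit (⊕-unfold m n)) (bit-bitCons (bit m xor bit n) (m / 2 ⊕ n / 2))

half-⊕ : ∀ m n → (m ⊕ n) / 2 ≡ m / 2 ⊕ n / 2
half-⊕ m n = trans (cong (_/ 2) (⊕-unfold m n)) (bitCons-half (bit m xor bit n) (m / 2 ⊕ n / 2))

infixl 7 _>>_
_>>_ : ℕ → ℕ → ℕ
n >> zero  = n
n >> suc k = n / 2 >> k

0>>k≡0 : ∀ k → 0 >> k ≡ 0
0>>k≡0 zero    = refl
0>>k≡0 (suc k) = 0>>k≡0 k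

>>-monoˡ-≤ : ∀ k {m n} → m ≤ n → m >> k ≤ n >> k
>>-monoˡ-≤ zero    m≤n = m≤n
>>-monoˡ-≤ (suc k) m≤n = >>-monoˡ-≤ k (/-monoˡ-≤ 2 m≤n)

<2^⇒>>≡0 : ∀ k {n} → n < 2 ^ k → n >> k ≡ 0
<2^⇒>>≡0 zero    (s≤s z≤n) = refl
<2^⇒>>≡0 (suc k) {n} n<2^1+k
  with bitCons-<-inv {bit n} {false} (subst (_< 2 ^ suc k) (sym (bitCons-bit-half n)) n<2^1+k)
... | inj₁ n/2<2^k = <2^⇒>>≡0 k n/2<2^k

>>≡0⇒<2^ : ∀ k {n} → n >> k ≡ 0 → n < 2 ^ k
>>≡0⇒<2^ zero    refl = s≤s z≤n
>>≡0⇒<2^ (suc k) {n} n>>1+k≡0 =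
  subst (_< 2 ^ suc k) (bitCons-bit-half n) (bitCons-< (bit n) false (>>≡0⇒<2^ k n>>1+k≡0))

⊕->> : ∀ m n k → (m ⊕ n) >> k ≡ m >> k ⊕ n >> k
⊕->> m n zero    = refl
⊕->> m n (suc k) = trans (cong (_>> k) (half-⊕ m n)) (⊕->> (m / 2) (n / 2) k)

bit-⊕->> : ∀ m n k → bit ((m ⊕ n) >> k) ≡ bit (m >> k) xor bit (n >> k)
bit-⊕->> m n k = trans (cong bit (⊕->> m n k)) (bit-⊕ (m >> k) (n >> k))

bitwise-ext : ∀ {m n} → (∀ k → bit (m >> k) ≡ bit (n >> k)) → m ≡ n
bitwise-ext {m} {n} = go (m≤m+n m n) (m≤n+m n m)
  where
  go : ∀ {f m n} → m ≤ f → n ≤ f → (∀ k → bit (m >> k) ≡ bit (n >> k)) → m ≡ n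
  go {zero}  z≤n z≤n _ = refl
  go {suc f} {m} {n} m≤ n≤ same = begin
    m                        ≡⟨ sym (bitCons-bit-half m) ⟩
    bitCons (bit m) (m / 2)  ≡⟨ cong₂ bitCons (same 0) (go (half-≤ m≤) (half-≤ n≤) (λ k → same (suc k))) ⟩
    bitCons (bit n) (n / 2)  ≡⟨ bitCons-bit-half n ⟩
    n                        ∎
    where open ≡-Reasoning

m⊕0≡m : ∀ m → m ⊕ 0 ≡ m
m⊕0≡m m = bitwise-ext λ k → begin
  bit ((m ⊕ 0) >> k)              ≡⟨ bit-⊕->> m 0 k ⟩
  bit (m >> k) xor bit (0 >> k)   ≡⟨ cong (λ z → bit (m >> k) xor bit z) (0>>k≡0 k) ⟩
  bit (m >> k) xor false          ≡⟨ xor-identityʳ (bit (m >> k)) ⟩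
  bit (m >> k)                    ∎
  where open ≡-Reasoning

m⊕m≡0 : ∀ m → m ⊕ m ≡ 0
m⊕m≡0 m = bitwise-ext λ k → begin
  bit ((m ⊕ m) >> k)              ≡⟨ bit-⊕->> m m k ⟩
  bit (m >> k) xor bit (m >> k)   ≡⟨ xor-same (bit (m >> k)) ⟩
  false                           ≡⟨ cong bit (sym (0>>k≡0 k)) ⟩
  bit (0 >> k)                    ∎
  where open ≡-Reasoning

m⊕n⊕n≡m : ∀ m n → m ⊕ n ⊕ n ≡ m
m⊕n⊕n≡m m n = bitwise-ext λ k → begin
  bit ((m ⊕ n ⊕ n) >> k)                      ≡⟨ bit-⊕->> (m ⊕ n) n k ⟩
  bit ((m ⊕ n) >> k) xor bit (n >> k)         ≡⟨ cong (_xor bit (n >> k)) (bit-⊕->> m n k) ⟩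
  (bit (m >> k) xor bit (n >> k)) xor bit (n >> k) ≡⟨ xor-assoc (bit (m >> k)) (bit (n >> k)) (bit (n >> k)) ⟩
  bit (m >> k) xor (bit (n >> k) xor bit (n >> k)) ≡⟨ cong (bit (m >> k) xor_) (xor-same (bit (n >> k))) ⟩
  bit (m >> k) xor false                      ≡⟨ xor-identityʳ (bit (m >> k)) ⟩
  bit (m >> k)                                ∎
  where open ≡-Reasoning

m⊕[m⊕n]≡n : ∀ m n → m ⊕ (m ⊕ n) ≡ n
m⊕[m⊕n]≡n m n = bitwise-ext λ k → begin
  bit ((m ⊕ (m ⊕ n)) >> k)                    ≡⟨ bit-⊕->> m (m ⊕ n) k ⟩
  bit (m >> k) xor bit ((m ⊕ n) >> k)         ≡⟨ cong (bit (m >> k) xor_) (bit-⊕->> m n k) ⟩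
  bit (m >> k) xor (bit (m >> k) xor bit (n >> k)) ≡⟨ xor-assoc (bit (m >> k)) (bit (m >> k)) (bit (n >> k)) ⟨
  (bit (m >> k) xor bit (m >> k)) xor bit (n >> k) ≡⟨ cong (_xor bit (n >> k)) (xor-same (bit (m >> k))) ⟩
  bit (n >> k)                                ∎
  where open ≡-Reasoning

⊕-cancelʳ-≡ : ∀ k {m n} → m ⊕ k ≡ n ⊕ k → m ≡ n
⊕-cancelʳ-≡ k {m} {n} eq = trans (sym (m⊕n⊕n≡m m k)) (trans (cong (_⊕ k) eq) (m⊕n⊕n≡m n k))

⊕-cancelˡ-≡ : ∀ k {m n} → k ⊕ m ≡ k ⊕ n → m ≡ n
⊕-cancelˡ-≡ k {m} {n} eq = trans (sym (m⊕[m⊕n]≡n k m)) (trans (cong (k ⊕_) eq) (m⊕[m⊕n]≡n k n))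

<-⊕⇒⊕<⊎⊕< : ∀ {a b c} → c < a ⊕ b → c ⊕ b < a ⊎ a ⊕ c < b
<-⊕⇒⊕<⊎⊕< {a} {b} {c} = go a b c (m≤m+n a b) (m≤n+m b a)
  where
  half-bound : ∀ {f} r q → bitCons r q ≤ suc f → q ≤ f
  half-bound r q le = subst (_≤ _) (bitCons-half r q) (half-≤ le)

  xor-true-< : ∀ r s q p → r xor s ≡ true → bitCons s q < bitCons r q ⊎ bitCons r p < bitCons s p
  xor-true-< true  false q p _ = inj₁ (n<1+n (2 * q))
  xor-true-< false true  q p _ = inj₂ (n<1+n (2 * p))

  go : ∀ {f} a b c → a ≤ f → b ≤ f → c < a ⊕ b → c ⊕ b < a ⊎ a ⊕ c < b
  go {zero} _ _ _ z≤n z≤n ()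
  go {suc f} a b c a≤ b≤ c< with toBits a | toBits b | toBits c
  ... | bits ra a₁ | bits rb b₁ | bits rc c₁
    rewrite bitCons-⊕ ra a₁ rb b₁ | bitCons-⊕ rc c₁ rb b₁ | bitCons-⊕ ra a₁ rc c₁
    with bitCons-<-inv {rc} {ra xor rb} {c₁} {a₁ ⊕ b₁} c<
  ... | inj₁ c₁< with go a₁ b₁ c₁ (half-bound ra a₁ a≤) (half-bound rb b₁ b≤) c₁<
  ...   | inj₁ lt = inj₁ (bitCons-< (rc xor rb) ra lt)
  ...   | inj₂ lt = inj₂ (bitCons-< (ra xor rc) rb lt)
  go _ _ _ a≤ b≤ c< | bits ra a₁ | bits rb b₁ | bits rc _ | inj₂ (refl , refl , ra⊕rb)
    rewrite m⊕n⊕n≡m a₁ b₁ | m⊕[m⊕n]≡n a₁ b₁ | xor-identityʳ ra = xor-true-< ra rb a₁ b₁ ra⊕rb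

⊕-low->> : ∀ K {a b} → b < 2 ^ K → (a ⊕ b) >> K ≡ a >> K
⊕-low->> K {a} {b} b<2^K = begin
  (a ⊕ b) >> K      ≡⟨ ⊕->> a b K ⟩
  a >> K ⊕ b >> K   ≡⟨ cong (a >> K ⊕_) (<2^⇒>>≡0 K b<2^K) ⟩
  a >> K ⊕ 0        ≡⟨ m⊕0≡m (a >> K) ⟩
  a >> K            ∎
  where open ≡-Reasoning

⊕-low-reverses-<⇒>>-≡ : ∀ K {a a′ b} → b < 2 ^ K → a′ < a → a ⊕ b < a′ ⊕ b → a′ >> K ≡ a >> K
⊕-low-reverses-<⇒>>-≡ K b<2^K a′<a ab<a′b = ≤-antisym
  (>>-monoˡ-≤ K (<⇒≤ a′<a))
  (subst₂ _≤_ (⊕-low->> K b<2^K) (⊕-low->> K b<2^K) (>>-monoˡ-≤ K (<⇒≤ ab<a′b)))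

⊕-invariant⇒>>-invariant : ∀ {ℓ} {A : Set ℓ} K (γ : ℕ → A) → (∀ i j → j < 2 ^ K → γ i ≡ γ (i ⊕ j)) →
                           ∀ {i i′} → i >> K ≡ i′ >> K → γ i ≡ γ i′
⊕-invariant⇒>>-invariant K γ inv {i} {i′} same = begin
  γ i                ≡⟨ inv i (i ⊕ i′) j<2^K ⟩
  γ (i ⊕ (i ⊕ i′))   ≡⟨ cong γ (m⊕[m⊕n]≡n i i′) ⟩
  γ i′               ∎
  where
  open ≡-Reasoning
  j<2^K : i ⊕ i′ < 2 ^ K
  j<2^K = >>≡0⇒<2^ K (trans (⊕->> i i′ K) (trans (cong (_⊕ i′ >> K) same) (m⊕m≡0 (i′ >> K))))

active : Game → Bool
active (mk _ _ g) = g

infix 4 _◃_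
data _◃_ : Game → Game → Set where
  option : ∀ {n f g} (i : Fin n) → f i ◃ mk n f g

anyFin⇒∃ : ∀ n p → anyFin n p ≡ true → ∃ λ (i : Fin n) → p i ≡ true
anyFin⇒∃ (suc n) p any with p zero in p0
... | true  = zero , p0
... | false with anyFin⇒∃ n (λ i → p (suc i)) any
...   | i , pi = suc i , pi

∃⇒anyFin : ∀ n p (i : Fin n) → p i ≡ true → anyFin n p ≡ true
∃⇒anyFin (suc n) p zero    pi rewrite pi = refl
∃⇒anyFin (suc n) p (suc i) pi rewrite ∃⇒anyFin n (λ i → p (suc i)) i pi = ∨-zeroʳ (p zero)

o≡𝒩⇒ : ∀ G → o G ≡ 𝒩 → active G ≡ true × ∃ λ G′ → G′ ◃ G × o G′ ≡ 𝒫
o≡𝒩⇒ (mk n f true) o≡𝒩 with anyFin n (λ i → isP (o (f i))) in any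
... | true with anyFin⇒∃ n (λ i → isP (o (f i))) any
...   | i , isP-fi = refl , f i , option i , isP⇒𝒫 isP-fi
  where
  isP⇒𝒫 : ∀ {x} → isP x ≡ true → x ≡ 𝒫
  isP⇒𝒫 {𝒫} _ = refl

o≡𝒩⇐ : ∀ {G G′} → active G ≡ true → G′ ◃ G → o G′ ≡ 𝒫 → o G ≡ 𝒩
o≡𝒩⇐ {mk n f true} refl (option i) o≡𝒫 with anyFin n (λ i → isP (o (f i)))
                                              | ∃⇒anyFin n (λ i → isP (o (f i))) i (cong isP o≡𝒫)
... | true | _ = refl

active-𝒫⇒options-𝒩 : ∀ {G G′} → active G ≡ true → o G ≡ 𝒫 → G′ ◃ G → o G′ ≡ 𝒩
active-𝒫⇒options-𝒩 {G′ = G′} act o≡𝒫 G′◃G with o G′ in o′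
... | 𝒩 = refl
... | 𝒫 with () ← trans (sym (o≡𝒩⇐ act G′◃G o′)) o≡𝒫

outcome-≡ : ∀ {x y} → (x ≡ 𝒩 → y ≡ 𝒩) → (y ≡ 𝒩 → x ≡ 𝒩) → x ≡ y
outcome-≡ {𝒩} {𝒩} _ _ = refl
outcome-≡ {𝒫} {𝒫} _ _ = refl
outcome-≡ {𝒩} {𝒫} x⇒y _ with () ← x⇒y refl
outcome-≡ {𝒫} {𝒩} _ y⇒x with () ← y⇒x refl

active-⊞ : ∀ G H → active (G ⊞ H) ≡ active G ∨ active H
active-⊞ (mk _ _ _) (mk _ _ _) = refl

◃-⊞ˡ : ∀ {G G′} H → G′ ◃ G → G′ ⊞ H ◃ G ⊞ H
◃-⊞ˡ {mk n f g} (mk m h k) (option i) =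
  subst (_◃ mk n f g ⊞ mk m h k) (cong [ _ , _ ]′ (splitAt-↑ˡ n i m)) (option (i ↑ˡ m))

◃-⊞ʳ : ∀ G {H H′} → H′ ◃ H → G ⊞ H′ ◃ G ⊞ H
◃-⊞ʳ (mk n f g) {mk m h k} (option j) =
  subst (_◃ mk n f g ⊞ mk m h k) (cong [ _ , _ ]′ (splitAt-↑ʳ n m j)) (option (n ↑ʳ j))

◃-⊞-inv : ∀ G H {Y} → Y ◃ G ⊞ H →
          (∃ λ G′ → G′ ◃ G × Y ≡ G′ ⊞ H) ⊎ (∃ λ H′ → H′ ◃ H × Y ≡ G ⊞ H′)
◃-⊞-inv (mk n f g) (mk m h k) (option i) with splitAt n i
... | inj₁ i′ = inj₁ (f i′ , option i′ , refl)
... | inj₂ j  = inj₂ (h j , option j , refl)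

module _ (γ : ℕ → Bool) where

  starOpts-< : ∀ {i j} → j < i → ∃ λ (k : Fin i) → starOpts γ i k ≡ star γ j
  starOpts-< {suc i} (s≤s j≤i) with m≤n⇒m<n∨m≡n j≤i
  ... | inj₂ refl = zero , refl
  ... | inj₁ j<i with starOpts-< j<i
  ...   | k , eq = suc k , eq

  ◃-star : ∀ {i j} → j < i → star γ j ◃ star γ i
  ◃-star {i} j<i with starOpts-< j<i
  ... | k , eq = subst (_◃ star γ i) eq (option k)

  starOpts-inv : ∀ i (k : Fin i) → ∃ λ j → j < i × starOpts γ i k ≡ star γ j
  starOpts-inv (suc i) zero    = i , ≤-refl , refl
  starOpts-inv (suc i) (suc k) with starOpts-inv i k
  ... | j , j<i , eq = j , m<n⇒m<1+n j<i , eq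

  ◃-star-inv : ∀ {i Y} → Y ◃ star γ i → ∃ λ j → j < i × Y ≡ star γ j
  ◃-star-inv {i} (option k) = starOpts-inv i k

  star-𝒫⇒𝒩 : ∀ {c d} X → c ≢ d → (d < c → γ c ≡ γ d) → active (star γ d ⊞ X) ≡ true →
             o (star γ c ⊞ X) ≡ 𝒫 → o (star γ d ⊞ X) ≡ 𝒩
  star-𝒫⇒𝒩 {c} {d} X c≢d γc≡γd act c𝒫 with <-cmp c d
  ... | tri< c<d _ _ = o≡𝒩⇐ act (◃-⊞ˡ X (◃-star c<d)) c𝒫
  ... | tri≈ _ c≡d _ = contradiction c≡d c≢d
  ... | tri> _ _ d<c = active-𝒫⇒options-𝒩 act′ c𝒫 (◃-⊞ˡ X (◃-star d<c))
    where
    act′ : active (star γ c ⊞ X) ≡ true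
    act′ = trans (active-⊞ (star γ c) X)
                 (trans (cong (_∨ active X) (γc≡γd d<c)) (trans (sym (active-⊞ (star γ d) X)) act))

◃-star⊞star-inv : ∀ γ δ {a b Y} → Y ◃ star γ a ⊞ star δ b →
                  (∃ λ a′ → a′ < a × Y ≡ star γ a′ ⊞ star δ b) ⊎ (∃ λ b′ → b′ < b × Y ≡ star γ a ⊞ star δ b′)
◃-star⊞star-inv γ δ {a} {b} Y◃ with ◃-⊞-inv (star γ a) (star δ b) Y◃
... | inj₁ (A′ , A′◃ , refl) with ◃-star-inv γ A′◃
...   | a′ , a′<a , refl = inj₁ (a′ , a′<a , refl)
◃-star⊞star-inv γ δ Y◃ | inj₂ (B′ , B′◃ , refl) with ◃-star-inv δ B′◃
...   | b′ , b′<b , refl = inj₂ (b′ , b′<b , refl)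

module _ (γ : ℕ → Bool) (K : ℕ) (inv : (i j : ℕ) → j < 2 ^ K → γ i ≡ γ (i ⊕ j)) where

  SumLaw : Game → ℕ → ℕ → Set
  SumLaw X a b = o (star γ a ⊞ star 𝟎 b ⊞ X) ≡ o (star γ (a ⊕ b) ⊞ X)

  γ-⊕ : ∀ a {b} → b < 2 ^ K → γ (a ⊕ b) ≡ γ a
  γ-⊕ a {b} b<2^K = sym (inv a b b<2^K)

  module InductiveStep (X : Game) (a b : ℕ) (b<2^K : b < 2 ^ K)
                       (ih-options : ∀ {X′} → X′ ◃ X → SumLaw X′ a b)
                       (ih-smaller : ∀ {a′ b′} → a′ + b′ < a + b → b′ < 2 ^ K → SumLaw X a′ b′) where

    S T : Game
    S = star γ a ⊞ star 𝟎 b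
    T = star γ (a ⊕ b)

    active-≡ : active (S ⊞ X) ≡ active (T ⊞ X)
    active-≡ = begin
      active (S ⊞ X)            ≡⟨ active-⊞ S X ⟩
      active S ∨ active X       ≡⟨ cong (_∨ active X) (active-⊞ (star γ a) (star 𝟎 b)) ⟩
      (γ a ∨ false) ∨ active X  ≡⟨ cong (_∨ active X) (∨-identityʳ (γ a)) ⟩
      γ a ∨ active X            ≡⟨ cong (_∨ active X) (γ-⊕ a b<2^K) ⟨
      γ (a ⊕ b) ∨ active X      ≡⟨ sym (active-⊞ T X) ⟩
      active (T ⊞ X)            ∎
      where open ≡-Reasoning

    γ-block : ∀ {a′} → a′ < a → a ⊕ b < a′ ⊕ b → γ (a′ ⊕ b) ≡ γ (a ⊕ b)
    γ-block {a′} a′<a d<c = begin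
      γ (a′ ⊕ b)  ≡⟨ γ-⊕ a′ b<2^K ⟩
      γ a′        ≡⟨ ⊕-invariant⇒>>-invariant K γ inv (⊕-low-reverses-<⇒>>-≡ K b<2^K a′<a d<c) ⟩
      γ a         ≡⟨ γ-⊕ a b<2^K ⟨
      γ (a ⊕ b)   ∎
      where open ≡-Reasoning

    fwd : o (S ⊞ X) ≡ 𝒩 → o (T ⊞ X) ≡ 𝒩
    fwd S⊞X𝒩 with o≡𝒩⇒ (S ⊞ X) S⊞X𝒩
    ... | act , Y , Y◃ , Y𝒫 with ◃-⊞-inv S X Y◃
    ... | inj₂ (X′ , X′◃X , refl) =
          o≡𝒩⇐ (trans (sym active-≡) act) (◃-⊞ʳ T X′◃X) (trans (sym (ih-options X′◃X)) Y𝒫)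
    ... | inj₁ (S′ , S′◃S , refl) with ◃-star⊞star-inv γ 𝟎 S′◃S
    ...   | inj₁ (a′ , a′<a , refl) =
          star-𝒫⇒𝒩 γ X (λ eq → <-irrefl (⊕-cancelʳ-≡ b eq) a′<a) (γ-block a′<a)
            (trans (sym active-≡) act)
            (trans (sym (ih-smaller (+-monoˡ-< b a′<a) b<2^K)) Y𝒫)
    ...   | inj₂ (b′ , b′<b , refl) =
          star-𝒫⇒𝒩 γ X (λ eq → <-irrefl (⊕-cancelˡ-≡ a eq) b′<b)
            (λ _ → trans (γ-⊕ a (<-trans b′<b b<2^K)) (sym (γ-⊕ a b<2^K)))
            (trans (sym active-≡) act)
            (trans (sym (ih-smaller (+-monoʳ-< a b′<b) (<-trans b′<b b<2^K))) Y𝒫)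

    bwd : o (T ⊞ X) ≡ 𝒩 → o (S ⊞ X) ≡ 𝒩
    bwd T⊞X𝒩 with o≡𝒩⇒ (T ⊞ X) T⊞X𝒩
    ... | act , Y , Y◃ , Y𝒫 with ◃-⊞-inv T X Y◃
    ... | inj₂ (X′ , X′◃X , refl) =
          o≡𝒩⇐ (trans active-≡ act) (◃-⊞ʳ S X′◃X) (trans (ih-options X′◃X) Y𝒫)
    ... | inj₁ (T′ , T′◃T , refl) with ◃-star-inv γ T′◃T
    ...   | c , c<d , refl with <-⊕⇒⊕<⊎⊕< c<d
    ...     | inj₁ a′<a =
          o≡𝒩⇐ (trans active-≡ act) (◃-⊞ˡ X (◃-⊞ˡ (star 𝟎 b) (◃-star γ a′<a)))
            (trans (ih-smaller (+-monoˡ-< b a′<a) b<2^K)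
                   (trans (cong (λ z → o (star γ z ⊞ X)) (m⊕n⊕n≡m c b)) Y𝒫))
    ...     | inj₂ b′<b =
          o≡𝒩⇐ (trans active-≡ act) (◃-⊞ˡ X (◃-⊞ʳ (star γ a) (◃-star 𝟎 b′<b)))
            (trans (ih-smaller (+-monoʳ-< a b′<b) (<-trans b′<b b<2^K))
                   (trans (cong (λ z → o (star γ z ⊞ X)) (m⊕[m⊕n]≡n a c)) Y𝒫))

    law : SumLaw X a b
    law = outcome-≡ fwd bwd

  sum-law : ∀ X {a b} → b < 2 ^ K → Acc _<_ (a + b) → SumLaw X a b
  sum-law (mk n f g) {a} {b} b<2^K (acc rs) = InductiveStep.law (mk n f g) a b b<2^K
    (λ { (option i) → sum-law (f i) b<2^K (<-wellFounded (a + b)) })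
    (λ a′+b′<a+b b′<2^K → sum-law (mk n f g) b′<2^K (rs a′+b′<a+b))

theorem3p53 : (γ : ℕ → Bool) (K : ℕ) →
    ((i j : ℕ) → j < 2 ^ K → γ i ≡ γ (i ⊕ j)) →
    (a b : ℕ) → b < 2 ^ K →
    star γ a ⊞ star 𝟎 b ≈G star γ (a ⊕ b)
theorem3p53 γ K inv a b b<2^K X = sum-law γ K inv X b<2^K (<-wellFounded (a + b))
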